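{- Let $\mathcal{C}\subseteq\mathbb{F}_q^{k\times m}$ be a non-zero linear code. Then $\rho(\mathcal{C})\le d(\mathcal{C}) - 1 + \lambda(S)$, where $S := ([k-d(\mathcal{C})+1]\times[m])\setminus\mathrm{in}(\mathcal{C})$.
   Context: $q$ prime power, $k\le m$ positive integers, $[n]=\{1,\dots,n\}$. A linear code is an $\mathbb{F}_q$-subspace of $\mathbb{F}_q^{k\times m}$, $d(\mathcal{C})$ its minimum nonzero rank, and $\rho(\mathcal{C})=\min\{i:\forall X\in\mathbb{F}_q^{k\times m}\ \exists M\in\mathcal{C},\ \mathrm{rk}(X-M)\le i\}$ its covering radius. With $\preceq$ the lexicographic order on $[k]\times[m]$, $\mathrm{in}(M)=\min_\preceq\{(i,j):M_{ij}\ne0\}$ for nonzero $M$, and $\mathrm{in}(\mathcal{C})=\{\mathrm{in}(M):M\in\mathcal{C}\setminus\{0\}\}$. For $S\subseteq[a]\times[b]$, $\lambda(S)$ is the minimum number of lines (rows or columns) of an $a\times b$ array needed to cover all positions in $S$. -}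

module Defs where

open import Level using (0ℓ)
open import Data.Nat using (ℕ; zero; suc; _∸_; _<_; _≤_)
import Data.Nat as ℕ
import Data.Fin as Fin
open import Data.Fin using (Fin; toℕ)
open import Data.Fin.Subset using (Subset; _∈_; ∣_∣)
open import Data.Product using (Σ; ∃; _×_; _,_)
open import Data.Sum using (_⊎_)
open import Relation.Nullary using (¬_)
open import Relation.Binary.PropositionalEquality using (_≡_; _≢_)
open import Function.Bundles using (_↔_)
open import Function.Definitions using (Injective)
open import Algebra.Structures using (IsCommutativeRing)

record FiniteField : Set₁ where
  field
    Carrier : Set
    _+_ _*_ : Carrier → Carrier → Carrier
    -_      : Carrier → Carrier
    0# 1#   : Carrier
    isCommutativeRing : IsCommutativeRing _≡_ _+_ _*_ -_ 0# 1#
    0≢1     : 0# ≢ 1#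
    inverse : ∀ x → x ≢ 0# → Σ Carrier (λ y → x * y ≡ 1#)
    size    : ℕ
    finite  : Carrier ↔ Fin size
  infixl 6 _+_
  infixl 7 _*_

module _ (F : FiniteField) where
  open FiniteField F

  Mat : ℕ → ℕ → Set
  Mat k m = Fin k → Fin m → Carrier

  zeroMat : ∀ {k m} → Mat k m
  zeroMat i j = 0#

  _⊕_ : ∀ {k m} → Mat k m → Mat k m → Mat k m
  (A ⊕ B) i j = A i j + B i j

  _⊖_ : ∀ {k m} → Mat k m → Mat k m → Mat k m
  (A ⊖ B) i j = A i j + (- B i j)

  _·_ : ∀ {k m} → Carrier → Mat k m → Mat k m
  (c · A) i j = c * A i j

  Σ[_] : ∀ {r} → (Fin r → Carrier) → Carrier
  Σ[_] {zero}  f = 0#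
  Σ[_] {suc r} f = f Fin.zero + Σ[_] (λ t → f (Fin.suc t))

  IndependentRows : ∀ {k m r} → Mat k m → (Fin r → Fin k) → Set
  IndependentRows {k} {m} {r} A f =
    (c : Fin r → Carrier) →
    (∀ j → Σ[ (λ t → c t * A (f t) j) ] ≡ 0#) →
    ∀ t → c t ≡ 0#

  RankAtLeast : ∀ {k m} → Mat k m → ℕ → Set
  RankAtLeast {k} {m} A r =
    Σ (Fin r → Fin k) λ f → Injective _≡_ _≡_ f × IndependentRows A f

  RankAtMost : ∀ {k m} → Mat k m → ℕ → Set
  RankAtMost A r = ¬ RankAtLeast A (suc r)

  HasRank : ∀ {k m} → Mat k m → ℕ → Set
  HasRank A r = RankAtLeast A r × RankAtMost A r

  record IsLinearCode {k m} (C : Mat k m → Set) : Set where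
    field
      has-zero : C zeroMat
      closed-+ : ∀ A B → C A → C B → C (A ⊕ B)
      closed-· : ∀ c A → C A → C (c · A)

  NonZeroMat : ∀ {k m} → Mat k m → Set
  NonZeroMat A = ∃ λ i → ∃ λ j → A i j ≢ 0#

  IsNonZeroCode : ∀ {k m} → (Mat k m → Set) → Set
  IsNonZeroCode C = ∃ λ A → C A × NonZeroMat A

  IsMinRankDistance : ∀ {k m} → (Mat k m → Set) → ℕ → Set
  IsMinRankDistance C d =
    (∃ λ A → C A × NonZeroMat A × HasRank A d) ×
    (∀ A → C A → NonZeroMat A → RankAtLeast A d)

  Covers : ∀ {k m} → (Mat k m → Set) → ℕ → Set
  Covers {k} {m} C i = ∀ (X : Mat k m) → ∃ λ M → C M × RankAtMost (X ⊖ M) i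

  IsCoveringRadius : ∀ {k m} → (Mat k m → Set) → ℕ → Set
  IsCoveringRadius C ρ = Covers C ρ × (∀ i → Covers C i → ρ ≤ i)

  _≺_ : ∀ {k m} → Fin k × Fin m → Fin k × Fin m → Set
  (i , j) ≺ (i' , j') = (toℕ i < toℕ i') ⊎ (i ≡ i' × toℕ j < toℕ j')

  IsInitial : ∀ {k m} → Mat k m → Fin k × Fin m → Set
  IsInitial A (i , j) =
    A i j ≢ 0# × (∀ i' j' → (i' , j') ≺ (i , j) → A i' j' ≡ 0#)

  InitialSet : ∀ {k m} → (Mat k m → Set) → Fin k × Fin m → Set
  InitialSet C p = ∃ λ A → C A × NonZeroMat A × IsInitial A p

LineCover : ∀ {a b} → (Fin a × Fin b → Set) → Subset a → Subset b → Set
LineCover S R K = ∀ i j → S (i , j) → (i ∈ R) ⊎ (j ∈ K)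

IsLineCoverNumber : ∀ {a b} → (Fin a × Fin b → Set) → ℕ → Set
IsLineCoverNumber {a} {b} S l =
  (∃ λ (R : Subset a) → ∃ λ (K : Subset b) → LineCover S R K × ∣ R ∣ ℕ.+ ∣ K ∣ ≡ l) ×
  (∀ (R : Subset a) (K : Subset b) → LineCover S R K → l ≤ ∣ R ∣ ℕ.+ ∣ K ∣)

-- Gaussian elimination along the lexicographic order shows that every matrix is congruent
-- modulo C to one that vanishes on any prescribed set of initial positions of C. If all
-- positions outside some rows R and columns K are initial, the reduced matrix lives on
-- these lines and so has rank at most |R| + |K|. Covering S by λ(S) lines and adding
-- the d - 1 rows below row k - d + 1 leaves only positions outside S in the top rows,
-- i.e. initial positions, which gives ρ ≤ d - 1 + λ(S).

module Submission where

open import Defs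
open import Level using (0ℓ)
import Data.Nat as ℕ
open import Data.Nat using (ℕ; zero; suc; pred; _+_; _∸_; _<_; _≤_; z≤n; s≤s)
open import Data.Nat.Properties
  using (≤-reflexive; ≤-trans; ≤-total; <-irrefl; <-asym; _≤?_; _<?_; ≮⇒≥; +-suc;
         +-monoˡ-≤; +-monoʳ-≤; +-monoˡ-<; +-monoʳ-<; +-cancelˡ-<; m<1+n⇒m<n∨m≡n; m≤n⇒m∸n≡0;
         m∸[m∸n]≡n; pred-mono-≤; pred[m∸n]≡m∸[1+n]; module ≤-Reasoning)
open import Data.Fin using (Fin; zero; suc; toℕ; fromℕ<; combine; remQuot)
import Data.Fin.Properties as Fin
open import Data.Fin.Subset using (Subset; _∈_; _∉_; ∣_∣; inside; outside; _∪_; ⊤; _-_)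
open import Data.Fin.Subset.Properties
  using (_∈?_; ∈⊤; ∣⊤∣≡n; ∣p∣≤∣x∷p∣; x∈p∪q⁺; x∈p∧x≢y⇒x∈p-y; x∈p⇒∣p-x∣<∣p∣)
open import Data.Vec.Base using ([]; _∷_; there)
import Data.Vec.Functional as Vector
open import Data.Product using (∃; _×_; _,_; proj₁; proj₂; uncurry)
open import Data.Sum using (_⊎_; inj₁; inj₂; [_,_]′)
open import Data.Empty using (⊥-elim)
open import Function.Base using (id; _∘_; case_of_)
open import Function.Definitions using (Injective)
open import Function.Properties.Inverse using (↔⇒↣)
open import Relation.Binary using (tri<; tri≈; tri>)
open import Relation.Binary.PropositionalEquality
  using (_≡_; _≢_; refl; sym; trans; cong; cong₂; subst; subst₂; module ≡-Reasoning)
open import Relation.Nullary using (¬_; Dec; yes; no; contradiction; ¬¬-map)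
open import Relation.Nullary.Decidable using (decidable-stable; via-injection; _×-dec_; ¬?)
open import Relation.Unary using (Decidable)
open import Algebra.Bundles using (CommutativeRing)
import Algebra.Properties.Ring as RingProperties
import Algebra.Properties.CommutativeSemigroup as CommutativeSemigroupProperties

∣p∪q∣≤∣p∣+∣q∣ : ∀ {n} (p q : Subset n) → ∣ p ∪ q ∣ ≤ ∣ p ∣ + ∣ q ∣
∣p∪q∣≤∣p∣+∣q∣ []            []            = z≤n
∣p∪q∣≤∣p∣+∣q∣ (inside ∷ p)  (s ∷ q)       =
  s≤s (≤-trans (∣p∪q∣≤∣p∣+∣q∣ p q) (+-monoʳ-≤ ∣ p ∣ (∣p∣≤∣x∷p∣ s q)))
∣p∪q∣≤∣p∣+∣q∣ (outside ∷ p) (inside ∷ q)  =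
  subst (suc ∣ p ∪ q ∣ ≤_) (sym (+-suc ∣ p ∣ ∣ q ∣)) (s≤s (∣p∪q∣≤∣p∣+∣q∣ p q))
∣p∪q∣≤∣p∣+∣q∣ (outside ∷ p) (outside ∷ q) = ∣p∪q∣≤∣p∣+∣q∣ p q

rowsFrom : ∀ k → ℕ → Subset k
rowsFrom zero    _       = []
rowsFrom (suc k) zero    = ⊤
rowsFrom (suc k) (suc h) = outside ∷ rowsFrom k h

∈rowsFrom : ∀ {k} h (i : Fin k) → h ≤ toℕ i → i ∈ rowsFrom k h
∈rowsFrom {suc k} zero    i       _         = ∈⊤
∈rowsFrom {suc k} (suc h) (suc i) (s≤s h≤i) = there (∈rowsFrom h i h≤i)

∣rowsFrom∣ : ∀ k h → ∣ rowsFrom k h ∣ ≡ k ∸ h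
∣rowsFrom∣ zero    zero    = refl
∣rowsFrom∣ zero    (suc h) = refl
∣rowsFrom∣ (suc k) zero    = ∣⊤∣≡n (suc k)
∣rowsFrom∣ (suc k) (suc h) = ∣rowsFrom∣ k h

m∸[m∸n]≤n : ∀ m n → m ∸ (m ∸ n) ≤ n
m∸[m∸n]≤n m n with ≤-total n m
... | inj₁ n≤m = ≤-reflexive (m∸[m∸n]≡n n≤m)
... | inj₂ m≤n rewrite m≤n⇒m∸n≡0 m≤n = m≤n

m∸[1+[m∸n]]≤n∸1 : ∀ m n → m ∸ suc (m ∸ n) ≤ n ∸ 1
m∸[1+[m∸n]]≤n∸1 m n = begin
  m ∸ suc (m ∸ n)    ≡⟨ pred[m∸n]≡m∸[1+n] m (m ∸ n) ⟨
  pred (m ∸ (m ∸ n)) ≤⟨ pred-mono-≤ (m∸[m∸n]≤n m n) ⟩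
  pred n             ≡⟨ pred[m∸n]≡m∸[1+n] n 0 ⟩
  n ∸ 1              ∎
  where open ≤-Reasoning

¬¬-→ : ∀ {A B : Set} → (A → ¬ ¬ B) → ¬ ¬ (A → B)
¬¬-→ f ¬[A→B] = ¬[A→B] (λ a → ⊥-elim (f a (λ b → ¬[A→B] (λ _ → b))))

¬¬-∀-Fin : ∀ {n} {P : Fin n → Set} → (∀ i → ¬ ¬ P i) → ¬ ¬ (∀ i → P i)
¬¬-∀-Fin {zero}  _   ¬∀ = ¬∀ (λ ())
¬¬-∀-Fin {suc n} ¬¬P ¬∀ =
  ¬¬P zero (λ P₀ → ¬¬-∀-Fin (¬¬P ∘ suc) (λ P₊ → ¬∀ (λ { zero → P₀ ; (suc i) → P₊ i })))

index : ∀ {k m} → Fin k × Fin m → ℕ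
index (i , j) = toℕ (combine i j)

index-injective : ∀ {k m} {p q : Fin k × Fin m} → index p ≡ index q → p ≡ q
index-injective {p = i , j} {i′ , j′} eq = cong₂ _,_
  (Fin.combine-injectiveˡ i j i′ j′ (Fin.toℕ-injective eq))
  (Fin.combine-injectiveʳ i j i′ j′ (Fin.toℕ-injective eq))

index<⇒lex : ∀ {k m} (i i′ : Fin k) (j j′ : Fin m) → index (i , j) < index (i′ , j′) →
             toℕ i < toℕ i′ ⊎ (i ≡ i′ × toℕ j < toℕ j′)
index<⇒lex {m = m} i i′ j j′ lt with Fin.<-cmp i i′
... | tri< i<i′ _ _ = inj₁ i<i′
... | tri≈ _ refl _ = inj₂ (refl , +-cancelˡ-< (m ℕ.* toℕ i) (toℕ j) (toℕ j′)
        (subst₂ _<_ (Fin.toℕ-combine i j) (Fin.toℕ-combine i j′) lt))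
... | tri> _ _ i′<i = contradiction (Fin.combine-monoˡ-< j′ j i′<i) (<-asym lt)

positionAt : ∀ k m n → (∃ λ (p : Fin k × Fin m) → index p ≡ n) ⊎ (∀ (p : Fin k × Fin m) → index p ≢ n)
positionAt k m n with n <? k ℕ.* m
... | yes n<km = inj₁ (remQuot {k} m (fromℕ< n<km) ,
  trans (cong toℕ (Fin.combine-remQuot {k} m (fromℕ< n<km))) (Fin.toℕ-fromℕ< n<km))
... | no n≮km = inj₂ (λ (i , j) index≡n → n≮km (subst (_< k ℕ.* m) index≡n (Fin.toℕ<n (combine i j))))

module _ (F : FiniteField) where
  open FiniteField F renaming (_+_ to _⊹_)

  commutativeRing : CommutativeRing 0ℓ 0ℓ
  commutativeRing = record { isCommutativeRing = isCommutativeRing }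

  open CommutativeRing commutativeRing
    using (+-assoc; +-comm; +-identityˡ; +-identityʳ; -‿inverseʳ; *-assoc; *-comm; *-identityˡ; *-identityʳ;
           zeroˡ; zeroʳ; distribˡ; distribʳ; +-commutativeSemigroup)
  open RingProperties (CommutativeRing.ring commutativeRing) using (-‿distribˡ-*; -‿+-comm)
  open CommutativeSemigroupProperties +-commutativeSemigroup using (interchange)

  _≟_ : (x y : Carrier) → Dec (x ≡ y)
  _≟_ = via-injection (↔⇒↣ finite) Fin._≟_

  ∑ : ∀ {n} → (Fin n → Carrier) → Carrier
  ∑ = Σ[_] F

  Independent : ∀ {n m} → (Fin n → Fin m → Carrier) → Set
  Independent v = IndependentRows F v id

  -- g labels the rows of v by rows of the ambient array, where the row cover R lives.
  SupportedOnLines : ∀ {n k m} → (Fin n → Fin m → Carrier) → (Fin n → Fin k) → Subset k → Subset m → Set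
  SupportedOnLines v g R K = ∀ t j → v t j ≢ 0# → g t ∈ R ⊎ j ∈ K

  ∑-zeroˡ : ∀ {n} (f : Fin n → Carrier) → ∑ (λ t → 0# * f t) ≡ 0#
  ∑-zeroˡ {zero}  f = refl
  ∑-zeroˡ {suc n} f = trans (cong₂ _⊹_ (zeroˡ (f zero)) (∑-zeroˡ (f ∘ suc))) (+-identityʳ 0#)

  ∑-linear : ∀ {n} (c x a : Fin n → Carrier) y →
             ∑ (λ t → c t * (x t ⊹ a t * y)) ≡ ∑ (λ t → c t * x t) ⊹ ∑ (λ t → c t * a t) * y
  ∑-linear {zero}  c x a y = sym (trans (cong (0# ⊹_) (zeroˡ y)) (+-identityʳ 0#))
  ∑-linear {suc n} c x a y = begin
    c₀ * (x zero ⊹ a zero * y) ⊹ ∑ (λ t → c (suc t) * (x (suc t) ⊹ a (suc t) * y))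
      ≡⟨ cong₂ _⊹_ (distribˡ c₀ (x zero) (a zero * y)) (∑-linear (c ∘ suc) (x ∘ suc) (a ∘ suc) y) ⟩
    (c₀ * x zero ⊹ c₀ * (a zero * y)) ⊹ (∑cx ⊹ ∑ca * y)
      ≡⟨ interchange _ _ _ _ ⟩
    (c₀ * x zero ⊹ ∑cx) ⊹ (c₀ * (a zero * y) ⊹ ∑ca * y)
      ≡⟨ cong ((c₀ * x zero ⊹ ∑cx) ⊹_) (cong (_⊹ ∑ca * y) (*-assoc c₀ (a zero) y)) ⟨
    (c₀ * x zero ⊹ ∑cx) ⊹ (c₀ * a zero * y ⊹ ∑ca * y)
      ≡⟨ cong ((c₀ * x zero ⊹ ∑cx) ⊹_) (distribʳ y (c₀ * a zero) ∑ca) ⟨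
    (c₀ * x zero ⊹ ∑cx) ⊹ (c₀ * a zero ⊹ ∑ca) * y
      ∎
    where
    open ≡-Reasoning
    c₀  = c zero
    ∑cx = ∑ (λ t → c (suc t) * x (suc t))
    ∑ca = ∑ (λ t → c (suc t) * a (suc t))

  x-[xy⁻¹]y≡0 : ∀ x y y⁻¹ → y * y⁻¹ ≡ 1# → x ⊹ - (x * y⁻¹ * y) ≡ 0#
  x-[xy⁻¹]y≡0 x y y⁻¹ yy⁻¹≡1 = begin
    x ⊹ - (x * y⁻¹ * y)   ≡⟨ cong (λ z → x ⊹ - z) (*-assoc x y⁻¹ y) ⟩
    x ⊹ - (x * (y⁻¹ * y)) ≡⟨ cong (λ z → x ⊹ - (x * z)) (trans (*-comm y⁻¹ y) yy⁻¹≡1) ⟩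
    x ⊹ - (x * 1#)        ≡⟨ cong (λ z → x ⊹ - z) (*-identityʳ x) ⟩
    x ⊹ - x               ≡⟨ -‿inverseʳ x ⟩
    0#                    ∎
    where open ≡-Reasoning

  x-[y+z]≡[x-y]-z : ∀ x y z → x ⊹ - (y ⊹ z) ≡ (x ⊹ - y) ⊹ - z
  x-[y+z]≡[x-y]-z x y z = trans (cong (x ⊹_) (sym (-‿+-comm y z))) (sym (+-assoc x (- y) (- z)))

  x+yz≢0⇒x≢0⊎z≢0 : ∀ x y z → x ⊹ y * z ≢ 0# → x ≢ 0# ⊎ z ≢ 0#
  x+yz≢0⇒x≢0⊎z≢0 x y z x+yz≢0 with x ≟ 0# | z ≟ 0#
  ... | no x≢0  | _       = inj₁ x≢0
  ... | yes _   | no z≢0  = inj₂ z≢0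
  ... | yes x≡0 | yes z≡0 = contradiction
        (trans (cong₂ (λ u w → u ⊹ y * w) x≡0 z≡0) (trans (+-identityˡ _) (zeroʳ y))) x+yz≢0

  independent-tail : ∀ {n m} {v : Fin (suc n) → Fin m → Carrier} → Independent v → Independent (v ∘ suc)
  independent-tail {v = v} ind c ∑≡0 t = ind (Vector._∷_ 0# c) ∑′≡0 (suc t)
    where
    ∑′≡0 : ∀ j → 0# * v zero j ⊹ ∑ (λ s → c s * v (suc s) j) ≡ 0#
    ∑′≡0 j = trans (cong (_⊹ ∑ (λ s → c s * v (suc s) j)) (zeroˡ (v zero j))) (trans (+-identityˡ _) (∑≡0 j))

  independent⇒head≢0 : ∀ {n m} {v : Fin (suc n) → Fin m → Carrier} → Independent v → ∃ λ j → v zero j ≢ 0#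
  independent⇒head≢0 {n} {m} {v} ind with Fin.all? (λ j → v zero j ≟ 0#)
  ... | no ¬head≡0 = Fin.¬∀⟶∃¬ m _ (λ j → v zero j ≟ 0#) ¬head≡0
  ... | yes head≡0 = contradiction (sym (ind (Vector._∷_ 1# (λ _ → 0#)) ∑≡0 zero)) 0≢1
    where
    ∑≡0 : ∀ j → 1# * v zero j ⊹ ∑ (λ s → 0# * v (suc s) j) ≡ 0#
    ∑≡0 j = trans (cong₂ _⊹_ (*-identityˡ (v zero j)) (∑-zeroˡ (λ s → v (suc s) j)))
                  (trans (+-identityʳ _) (head≡0 j))

  sweep : ∀ {n m} → (Fin n → Carrier) → (Fin (suc n) → Fin m → Carrier) → Fin n → Fin m → Carrier
  sweep b v t j = v (suc t) j ⊹ b t * v zero j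

  -- A relation c among the swept rows lifts to the relation (∑ c b , c) among the original rows.
  independent-sweep : ∀ {n m} b {v : Fin (suc n) → Fin m → Carrier} → Independent v → Independent (sweep b v)
  independent-sweep b {v} ind c ∑≡0 t = ind (Vector._∷_ (∑ (λ s → c s * b s)) c) ∑′≡0 (suc t)
    where
    ∑′≡0 : ∀ j → ∑ (λ s → c s * b s) * v zero j ⊹ ∑ (λ s → c s * v (suc s) j) ≡ 0#
    ∑′≡0 j = trans (+-comm _ _) (trans (sym (∑-linear c (λ s → v (suc s) j) b (v zero j))) (∑≡0 j))

  supportedOnLines-tail : ∀ {n k m} {v : Fin (suc n) → Fin m → Carrier} {g : Fin (suc n) → Fin k} {R K} →
    Injective _≡_ _≡_ g → SupportedOnLines v g R K → SupportedOnLines (v ∘ suc) (g ∘ suc) (R - g zero) K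
  supportedOnLines-tail g-inj supp t j v≢0 with supp (suc t) j v≢0
  ... | inj₁ g∈R = inj₁ (x∈p∧x≢y⇒x∈p-y g∈R (Fin.0≢1+n ∘ sym ∘ g-inj))
  ... | inj₂ j∈K = inj₂ j∈K

  supportedOnLines-sweep : ∀ {n k m} b {v : Fin (suc n) → Fin m → Carrier} {g : Fin (suc n) → Fin k} {R K} →
    g zero ∉ R → SupportedOnLines v g R K → SupportedOnLines (sweep b v) (g ∘ suc) R K
  supportedOnLines-sweep b {v} g₀∉R supp t j w≢0 with x+yz≢0⇒x≢0⊎z≢0 _ (b t) _ w≢0
  ... | inj₁ v≢0 = supp (suc t) j v≢0
  ... | inj₂ v₀≢0 = inj₂ ([ (λ g₀∈R → contradiction g₀∈R g₀∉R) , id ]′ (supp zero j v₀≢0))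

  supportedOnLines-clearColumn : ∀ {n k m} {v : Fin n → Fin m → Carrier} {g : Fin n → Fin k} {R K} j₀ →
    (∀ t → v t j₀ ≡ 0#) → SupportedOnLines v g R K → SupportedOnLines v g R (K - j₀)
  supportedOnLines-clearColumn j₀ column≡0 supp t j v≢0 with j Fin.≟ j₀
  ... | yes refl = contradiction (column≡0 t) v≢0
  ... | no j≢j₀ = [ inj₁ , (λ j∈K → inj₂ (x∈p∧x≢y⇒x∈p-y j∈K j≢j₀)) ]′ (supp t j v≢0)

  -- Induction on the number of rows: a row labelled in R is dropped together with its label;
  -- otherwise it has a pivot in some column of K, which is cleared from the other rows.
  independent⇒≤lines : ∀ {n k m} (v : Fin n → Fin m → Carrier) (g : Fin n → Fin k) → Injective _≡_ _≡_ g →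
    (R : Subset k) (K : Subset m) → SupportedOnLines v g R K → Independent v → n ≤ ∣ R ∣ + ∣ K ∣
  independent⇒≤lines {zero} _ _ _ _ _ _ _ = z≤n
  independent⇒≤lines {suc n} v g g-inj R K supp ind with g zero ∈? R
  ... | yes g₀∈R = begin-strict
    n                      ≤⟨ independent⇒≤lines (v ∘ suc) (g ∘ suc) (Fin.suc-injective ∘ g-inj) (R - g zero) K
                                (supportedOnLines-tail g-inj supp) (independent-tail {v = v} ind) ⟩
    ∣ R - g zero ∣ + ∣ K ∣ <⟨ +-monoˡ-< ∣ K ∣ (x∈p⇒∣p-x∣<∣p∣ g₀∈R) ⟩
    ∣ R ∣ + ∣ K ∣          ∎
    where open ≤-Reasoning
  ... | no g₀∉R = begin-strict
    n                    ≤⟨ independent⇒≤lines (sweep b v) (g ∘ suc) (Fin.suc-injective ∘ g-inj) R (K - j₀)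
                              (supportedOnLines-clearColumn j₀ pivot-cleared (supportedOnLines-sweep b g₀∉R supp))
                              (independent-sweep b {v} ind) ⟩
    ∣ R ∣ + ∣ K - j₀ ∣   <⟨ +-monoʳ-< ∣ R ∣ (x∈p⇒∣p-x∣<∣p∣ j₀∈K) ⟩
    ∣ R ∣ + ∣ K ∣        ∎
    where
    open ≤-Reasoning
    j₀ = proj₁ (independent⇒head≢0 {v = v} ind)
    pivot≢0 = proj₂ (independent⇒head≢0 {v = v} ind)
    j₀∈K : j₀ ∈ K
    j₀∈K = [ (λ g₀∈R → contradiction g₀∈R g₀∉R) , id ]′ (supp zero j₀ pivot≢0)
    pivot⁻¹ = proj₁ (inverse _ pivot≢0)
    b : Fin n → Carrier
    b t = - (v (suc t) j₀ * pivot⁻¹)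
    pivot-cleared : ∀ t → sweep b v t j₀ ≡ 0#
    pivot-cleared t = trans (cong (v (suc t) j₀ ⊹_) (sym (-‿distribˡ-* _ _)))
                            (x-[xy⁻¹]y≡0 _ _ pivot⁻¹ (proj₂ (inverse _ pivot≢0)))

  rankAtMost-lines : ∀ {k m} (A : Mat F k m) (R : Subset k) (K : Subset m) → SupportedOnLines A id R K →
                     ∀ {N} → ∣ R ∣ + ∣ K ∣ ≤ N → RankAtMost F A N
  rankAtMost-lines A R K supp bound (f , f-inj , ind) =
    <-irrefl refl (≤-trans (independent⇒≤lines (A ∘ f) f f-inj R K (supp ∘ f) ind) bound)

  module _ {k m} {C : Mat F k m → Set} (code : IsLinearCode F C) (X : Mat F k m) where
    open IsLinearCode code

    ClearedBelow : (Fin k × Fin m → Set) → ℕ → Mat F k m → Set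
    ClearedBelow T n M = ∀ p → T p → index p < n → uncurry (_⊖_ F X M) p ≡ 0#

    clear : ∀ M p → C M → InitialSet F C p →
            ∃ λ M′ → C M′ × uncurry (_⊖_ F X M′) p ≡ 0# ×
                     (∀ q → index q < index p → uncurry (_⊖_ F X M′) q ≡ uncurry (_⊖_ F X M) q)
    clear M (i , j) CM (A , CA , _ , Aij≢0 , A-before≡0) =
      _⊕_ F M (_·_ F c A) , closed-+ M _ CM (closed-· c A CA) , cleared , unchanged
      where
      Aij⁻¹ = proj₁ (inverse _ Aij≢0)
      c = (X i j ⊹ - M i j) * Aij⁻¹
      cleared : X i j ⊹ - (M i j ⊹ c * A i j) ≡ 0#
      cleared = trans (x-[y+z]≡[x-y]-z _ _ _) (x-[xy⁻¹]y≡0 _ _ Aij⁻¹ (proj₂ (inverse _ Aij≢0)))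
      unchanged : ∀ q → index q < index (i , j) → uncurry (_⊖_ F X (_⊕_ F M (_·_ F c A))) q ≡ uncurry (_⊖_ F X M) q
      unchanged (i′ , j′) lt = cong (λ z → X i′ j′ ⊹ - z) (begin
        M i′ j′ ⊹ c * A i′ j′ ≡⟨ cong (λ z → M i′ j′ ⊹ c * z) (A-before≡0 i′ j′ (index<⇒lex i′ i j′ j lt)) ⟩
        M i′ j′ ⊹ c * 0#      ≡⟨ cong (M i′ j′ ⊹_) (zeroʳ c) ⟩
        M i′ j′ ⊹ 0#          ≡⟨ +-identityʳ _ ⟩
        M i′ j′               ∎)
        where open ≡-Reasoning

    clearedBelow-suc : ∀ {T n M} → ClearedBelow T n M →
                       (∀ q → T q → index q ≡ n → uncurry (_⊖_ F X M) q ≡ 0#) → ClearedBelow T (suc n) M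
    clearedBelow-suc below at q Tq lt = [ below q Tq , at q Tq ]′ (m<1+n⇒m<n∨m≡n lt)

    clearBelow : (T : Fin k × Fin m → Set) → Decidable T → (∀ p → T p → InitialSet F C p) →
                 ∀ n → ∃ λ M → C M × ClearedBelow T n M
    clearBelow T T? initial zero = zeroMat F , has-zero , λ _ _ ()
    clearBelow T T? initial (suc n) with clearBelow T T? initial n
    ... | M , CM , cleared = step (positionAt k m n)
      where
      step : (∃ λ p → index p ≡ n) ⊎ (∀ p → index p ≢ n) → ∃ λ M′ → C M′ × ClearedBelow T (suc n) M′
      step (inj₂ none) = M , CM , clearedBelow-suc cleared (λ q _ q≡n → contradiction q≡n (none q))
      step (inj₁ (p , p≡n)) with T? p
      ... | no ¬Tp = M , CM , clearedBelow-suc cleared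
        (λ q Tq q≡n → contradiction (subst T (index-injective (trans q≡n (sym p≡n))) Tq) ¬Tp)
      ... | yes Tp with clear M p CM (initial p Tp)
      ...   | M′ , CM′ , p-cleared , unchanged = M′ , CM′ , clearedBelow-suc
        (λ q Tq q<n → trans (unchanged q (subst (index q <_) (sym p≡n) q<n)) (cleared q Tq q<n))
        (λ q _ q≡n → subst (λ r → uncurry (_⊖_ F X M′) r ≡ 0#) (index-injective (trans p≡n (sym q≡n))) p-cleared)

  covers-offLines : ∀ {k m} {C : Mat F k m → Set} → IsLinearCode F C → (R : Subset k) (K : Subset m) →
                    (∀ i j → i ∉ R × j ∉ K → InitialSet F C (i , j)) →
                    ∀ {N} → ∣ R ∣ + ∣ K ∣ ≤ N → Covers F C N
  covers-offLines {k} {m} code R K initial bound X with clearBelow code X OffLines offLines? (uncurry initial) (k ℕ.* m)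
    where
    OffLines : Fin k × Fin m → Set
    OffLines (i , j) = i ∉ R × j ∉ K
    offLines? : Decidable OffLines
    offLines? (i , j) = ¬? (i ∈? R) ×-dec ¬? (j ∈? K)
  ... | M , CM , cleared = M , CM , rankAtMost-lines (_⊖_ F X M) R K supported bound
    where
    supported : SupportedOnLines (_⊖_ F X M) id R K
    supported i j Y≢0 with i ∈? R | j ∈? K
    ... | yes i∈R | _       = inj₁ i∈R
    ... | no _    | yes j∈K = inj₂ j∈K
    ... | no i∉R  | no j∉K  = contradiction (cleared (i , j) (i∉R , j∉K) (Fin.toℕ<n (combine i j))) Y≢0

theorem5p5 : (F : FiniteField) (k m : ℕ) → k ≤ m → (C : Mat F k m → Set) →
    IsLinearCode F C → IsNonZeroCode F C →
    (d ρ l : ℕ) → IsMinRankDistance F C d → IsCoveringRadius F C ρ →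
    IsLineCoverNumber (λ p → (toℕ (proj₁ p) < suc (k ∸ d)) × ¬ InitialSet F C p) l →
    ρ ≤ d ∸ 1 + l
theorem5p5 F k m _ C code _ d ρ l _ (_ , minimal) ((R , K , cover , ∣R∣+∣K∣≡l) , _) =
  decidable-stable (ρ ≤? d ∸ 1 + l) (¬¬-map (minimal _ ∘ covers) offLines-initial)
  where
  B = rowsFrom k (suc (k ∸ d))
  R′ = B ∪ R
  bound : ∣ R′ ∣ + ∣ K ∣ ≤ d ∸ 1 + l
  bound = begin
    ∣ B ∪ R ∣ + ∣ K ∣       ≤⟨ +-monoˡ-≤ ∣ K ∣ (∣p∪q∣≤∣p∣+∣q∣ B R) ⟩
    ∣ B ∣ + ∣ R ∣ + ∣ K ∣   ≡⟨ Data.Nat.Properties.+-assoc (∣ B ∣) (∣ R ∣) (∣ K ∣) ⟩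
    ∣ B ∣ + (∣ R ∣ + ∣ K ∣) ≡⟨ cong₂ _+_ (∣rowsFrom∣ k (suc (k ∸ d))) ∣R∣+∣K∣≡l ⟩
    k ∸ suc (k ∸ d) + l     ≤⟨ +-monoˡ-≤ l (m∸[1+[m∸n]]≤n∸1 k d) ⟩
    d ∸ 1 + l               ∎
    where open ≤-Reasoning
  covers : (∀ i j → i ∉ R′ × j ∉ K → InitialSet F C (i , j)) → Covers F C (d ∸ 1 + l)
  covers initial = covers-offLines F code R′ K initial bound
  -- Membership in in(C) is undecidable here, so it is only obtained under ¬ ¬, which the
  -- decidability of ρ ≤ d - 1 + l then discharges.
  offLines-initial : ¬ ¬ (∀ i j → i ∉ R′ × j ∉ K → InitialSet F C (i , j))
  offLines-initial = ¬¬-∀-Fin λ i → ¬¬-∀-Fin λ j → ¬¬-→ λ where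
    (i∉R′ , j∉K) ¬initial → case toℕ i <? suc (k ∸ d) of λ where
      (no i≮h)  → i∉R′ (x∈p∪q⁺ (inj₁ (∈rowsFrom _ i (≮⇒≥ i≮h))))
      (yes i<h) → [ i∉R′ ∘ x∈p∪q⁺ ∘ inj₂ , j∉K ]′ (cover i j (i<h , ¬initial))
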